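{- Let $G\subseteq W_{2g}$ be a transitive subgroup containing $\iota$, and let $w$ be the weight function associated to a Newton polygon with distinct slopes $s_1,\dots,s_m$ of horizontal lengths $l_1,\dots,l_m$. If $\gcd(l_1,\dots,l_m)=1$, then the weighted permutation representation $\rho=(w,G)$ is geometrically simple.
   Context: $X_{2g}=\{1,\dots,g,\bar g,\dots,\bar1\}$, $W_{2g}\subseteq\mathrm{Sym}(X_{2g})$ the stabilizer of the partition into pairs $\{i,\bar i\}$, $\iota=(1\,\bar1)\cdots(g\,\bar g)$. A weight function is $w:X_{2g}\to\mathbb{Q}_{\ge0}$ with $w(i)\le w(j)$ for $1\le i\le j\le g$, $w(i)+w(\bar i)=1$, and every value $s$ attained a number of times divisible by the denominator of $s$; the weight function associated to a Newton polygon (with $2g$ slopes counted with multiplicity) is the one whose values, listed in the order $1,\dots,g,\bar g,\dots,\bar1$, are the slopes in increasing order, so slope $s_i$ is attained $l_i$ times. A weighted permutation representation is $\rho=(w,G)$ with $G\subseteq W_{2g}$ transitive containing $\iota$. $\Phi_\rho:\mathbb{Q}\langle X_{2g}\rangle\to\mathbb{Q}\langle G\rangle$ is the linear map $\Phi_\rho(x)=\sum_{\sigma\in G}w(\sigma^{ -1}(x))\sigma$; $\rho$ is geometrically simple if $\mathrm{Stab}_G(\Phi_\rho(1))=\mathrm{Stab}_G(1)$. -}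

module Defs where

open import Data.Nat as ℕ using (ℕ; zero; suc; _+_; NonZero)
open import Data.Nat.GCD using (gcd)
open import Data.Fin as Fin using (Fin; zero; suc; toℕ; opposite)
open import Data.Fin.Permutation using (Permutation′; _⟨$⟩ʳ_; _⟨$⟩ˡ_; id; flip; _∘ₚ_)
open import Data.Rational as ℚ using (ℚ; 0ℚ; 1ℚ; _-_)
open import Data.Product using (Σ; ∃; _×_; _,_)
open import Relation.Binary.PropositionalEquality using (_≡_)
open import Data.Nat.Divisibility using (_∣_)

-- The set X_{2g} = {1,…,g, ḡ,…,1̄} is modelled by Fin (g + g):
-- position k (0 ≤ k < g) is the element k+1, and position g+k is the
-- element (g-k)‾.  Hence the bar involution i ↦ ī is Fin.opposite
-- (k ↦ 2g-1-k), and the element 1 is position zero.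

X : ℕ → Set
X g = Fin (g + g)

bar : (g : ℕ) → X g → X g
bar g = opposite

one : (g : ℕ) → .{{NonZero g}} → X g
one (suc g) = zero

record Perm (g : ℕ) : Set where
  constructor perm
  field
    π : Permutation′ (g + g)
open Perm public

app : ∀ {g} → Perm g → X g → X g
app σ x = π σ ⟨$⟩ʳ x

appInv : ∀ {g} → Perm g → X g → X g
appInv σ x = π σ ⟨$⟩ˡ x

-- Composition σ · τ = σ ∘ τ (first τ, then σ).  Note _∘ₚ_ is diagrammatic.
_·_ : ∀ {g} → Perm g → Perm g → Perm g
σ · τ = perm (π τ ∘ₚ π σ)

inv : ∀ {g} → Perm g → Perm g
inv σ = perm (flip (π σ))

InW : ∀ {g} → Perm g → Set
InW {g} σ = ∀ (x : X g) → app σ (bar g x) ≡ bar g (app σ x)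

record IsSubgroupOfW (g : ℕ) (G : Perm g → Set) : Set where
  field
    respects : ∀ σ τ → (∀ x → app σ x ≡ app τ x) → G σ → G τ
    ⊆W       : ∀ σ → G σ → InW σ
    id∈      : G (perm id)
    ·∈       : ∀ σ τ → G σ → G τ → G (σ · τ)
    inv∈     : ∀ σ → G σ → G (inv σ)

Transitive : ∀ {g} → (Perm g → Set) → Set
Transitive {g} G = ∀ (x y : X g) → ∃ λ σ → G σ × app σ x ≡ y

Containsι : ∀ {g} → (Perm g → Set) → Set
Containsι {g} G = ∃ λ σ → G σ × (∀ (x : X g) → app σ x ≡ bar g x)

-- The group algebra ℚ⟨G⟩, modelled as coefficient functions on
-- permutations (only the values at σ ∈ G matter); equality of two
-- elements means equal coefficients at every σ ∈ G.

QG : ℕ → Set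
QG g = Perm g → ℚ

_≈[_]_ : ∀ {g} → QG g → (Perm g → Set) → QG g → Set
_≈[_]_ {g} a G b = ∀ σ → G σ → a σ ≡ b σ

-- Left multiplication action of τ on ℚ⟨G⟩:  τ · (Σ a_σ σ) = Σ a_σ (τσ),
-- so the coefficient at σ is a_{τ⁻¹σ}.
actQG : ∀ {g} → Perm g → QG g → QG g
actQG τ a σ = a (inv τ · σ)

Φ : ∀ {g} → (X g → ℚ) → X g → QG g
Φ w x σ = w (appInv σ x)

-- ρ = (w, G) is geometrically simple : Stab_G(Φ_ρ(1)) = Stab_G(1),
-- stated as equality of subsets of G.
GeometricallySimple : (g : ℕ) → .{{NonZero g}} → (X g → ℚ) → (Perm g → Set) → Set
GeometricallySimple g w G =
  ∀ τ → G τ →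
    ((actQG τ (Φ w (one g)) ≈[ G ] Φ w (one g)) → app τ (one g) ≡ one g)
    × (app τ (one g) ≡ one g → actQG τ (Φ w (one g)) ≈[ G ] Φ w (one g))

sumF : ∀ {m} → (Fin m → ℕ) → ℕ
sumF {zero}  l = 0
sumF {suc m} l = l zero + sumF (λ i → l (suc i))

pre : ∀ {m} → (Fin m → ℕ) → Fin m → ℕ
pre l zero    = 0
pre l (suc i) = l zero + pre (λ j → l (suc j)) i

gcdF : ∀ {m} → (Fin m → ℕ) → ℕ
gcdF {zero}  l = 0
gcdF {suc m} l = gcd (l zero) (gcdF (λ i → l (suc i)))

record NewtonPolygon (g : ℕ) : Set where
  field
    m       : ℕ
    slope   : Fin m → ℚ
    len     : Fin m → ℕ
    increasing : ∀ i j → i Fin.< j → slope i ℚ.< slope j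
    len-pos    : ∀ i → 0 ℕ.< len i
    total      : sumF len ≡ g + g
    slope-≥0   : ∀ i → 0ℚ ℚ.≤ slope i
    slope-≤1   : ∀ i → slope i ℚ.≤ 1ℚ
    integral   : ∀ i → ℚ.denominatorℕ (slope i) ∣ len i
    symmetric-slope : ∀ i → slope (opposite i) ≡ 1ℚ - slope i
    symmetric-len   : ∀ i → len (opposite i) ≡ len i
open NewtonPolygon public

-- w is the weight function associated to the Newton polygon N: listing
-- X_{2g} in the order 1,…,g,ḡ,…,1̄ (= positions 0,…,2g-1), the values of w
-- are the slopes in increasing order, slope s_i occupying l_i positions.
IsAssociatedWeight : ∀ {g} → NewtonPolygon g → (X g → ℚ) → Set
IsAssociatedWeight {g} N w =
  ∀ (k : X g) (i : Fin (m N)) →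
    pre (len N) i ℕ.≤ toℕ k → toℕ k ℕ.< pre (len N) i + len N i →
    w k ≡ slope N i

module Submission where

-- Call two points of X indistinguishable when every G-translate of w takes the same
-- value at them.  This is a G-invariant equivalence relation, so by transitivity of G
-- all its classes have one size d.  The level sets of w are the slope blocks, each a
-- union of classes, so d divides every l_i and therefore d = 1: indistinguishable
-- points are equal.  If τ stabilises Φ(1), then τ(1) is indistinguishable from 1.
-- Indistinguishability quantifies over G, which is only a predicate, so it is decided
-- under a double negation; this is harmless because τ(1) = 1 is itself decidable.

open import Defs
open import Data.Nat using (ℕ; NonZero)
open import Data.Rational using (ℚ)
open import Relation.Binary.PropositionalEquality using (_≡_)

open import Data.Nat using (zero; suc; _+_; _≤_; _<_; z≤n; s≤s; s≤s⁻¹)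
open import Data.Nat.Properties
  using (+-0-commutativeMonoid; _≤?_; _<?_; ≤-refl; ≤-trans; ≮⇒≥; m≤n⇒∃[o]m+o≡n;
         +-cancelˡ-<; m≤m+n; +-monoʳ-≤; +-monoˡ-≤; +-monoʳ-<; +-mono-≤; +-assoc; m≤n+m; 1+n≰n)
open import Data.Nat.Divisibility using (_∣_; _∣0; ∣-refl; ∣m∣n⇒∣m+n; ∣1⇒≡1)
open import Data.Nat.GCD using (gcd-greatest)
open import Algebra.Properties.CommutativeMonoid.Sum +-0-commutativeMonoid
  using (sum; sum-cong-≗; sum-permute; ∑-distrib-+; sum-replicate-zero)
open import Data.Bool as Bool using (Bool; true; false; _∧_; not; if_then_else_)
open import Data.Bool.Properties using (∧-zeroʳ; ¬-not)
open import Data.Fin as Fin using (Fin; zero; suc; toℕ)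
open import Data.Fin.Properties using (toℕ<n; any?; ∀-cons) renaming (<-cmp to <-cmpᶠ)
open import Data.Fin.Permutation using (Permutation′; _⟨$⟩ʳ_; id; flip; inverseˡ; inverseʳ)
import Data.Rational.Properties as ℚ
open import Data.Product using (∃; _×_; _,_)
open import Data.Empty using (⊥-elim)
open import Function.Base using (_∘_)
open import Function.Bundles using (mk⇔)
open import Function.Definitions using (Injective)
open import Level using (0ℓ)
open import Relation.Binary.Core using (Rel)
open import Relation.Binary.Definitions using (Decidable; tri<; tri≈; tri>)
open import Relation.Binary.Structures using (IsEquivalence; IsDecEquivalence)
open import Relation.Binary.PropositionalEquality
  using (_≢_; _≗_; refl; sym; trans; cong; cong₂; subst; subst₂)
open import Relation.Nullary using (¬_; Dec; yes; no; does; _×-dec_)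
open import Relation.Nullary.Decidable
  using (does-⇔; dec-true; dec-false; decidable-stable; ¬¬-excluded-middle)

indicator : ∀ {n} → (Fin n → Bool) → Fin n → ℕ
indicator p z = if p z then 1 else 0

count : ∀ {n} → (Fin n → Bool) → ℕ
count p = sum (indicator p)

module _ {n : ℕ} where

  count-cong : {p q : Fin n → Bool} → p ≗ q → count p ≡ count q
  count-cong p≗q = sum-cong-≗ (cong (λ b → if b then 1 else 0) ∘ p≗q)

  count-false : count {n} (λ _ → false) ≡ 0
  count-false = sum-replicate-zero n

  count-∧-split : (p q : Fin n → Bool) →
                  count p ≡ count (λ z → p z ∧ q z) + count (λ z → p z ∧ not (q z))
  count-∧-split p q = trans (sum-cong-≗ split) (∑-distrib-+ (indicator p∧q) (indicator p∧¬q))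
    where
    p∧q p∧¬q : Fin n → Bool
    p∧q  z = p z ∧ q z
    p∧¬q z = p z ∧ not (q z)
    split : ∀ z → indicator p z ≡ indicator p∧q z + indicator p∧¬q z
    split z with p z | q z
    ... | false | _     = refl
    ... | true  | true  = refl
    ... | true  | false = refl

  count-permute : (p : Fin n → Bool) (π : Permutation′ n) → count p ≡ count (λ z → p (π ⟨$⟩ʳ z))
  count-permute p = sum-permute _

count-pos : ∀ {n} (p : Fin n → Bool) {x} → p x ≡ true → 0 < count p
count-pos p {zero}  px rewrite px = s≤s z≤n
count-pos p {suc x} px = ≤-trans (count-pos (p ∘ suc) px) (m≤n+m _ _)

distinct⇒1<count : ∀ {n} (p : Fin n → Bool) {x y} → x ≢ y → p x ≡ true → p y ≡ true → 1 < count p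
distinct⇒1<count p {x} {y} x≢y px py =
  subst (1 <_) (sym (count-∧-split p is-x)) (+-mono-≤ (count-pos _ {x} px∧x) (count-pos _ {y} py∧¬x))
  where
  is-x : Fin _ → Bool
  is-x z = does (z Fin.≟ x)
  px∧x : p x ∧ is-x x ≡ true
  px∧x = cong₂ _∧_ px (dec-true (x Fin.≟ x) refl)
  py∧¬x : p y ∧ not (is-x y) ≡ true
  py∧¬x = cong₂ _∧_ py (cong not (dec-false (y Fin.≟ x) (x≢y ∘ sym)))

module _ {n ℓ} {_∼_ : Rel (Fin n) ℓ} (∼-isDecEquivalence : IsDecEquivalence _∼_) where
  open IsDecEquivalence ∼-isDecEquivalence
    using (_≟_) renaming (refl to ∼-refl; sym to ∼-sym; trans to ∼-trans)

  class : Fin n → Fin n → Bool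
  class x z = does (z ≟ x)

  Saturated : (Fin n → Bool) → Set ℓ
  Saturated L = ∀ {a b} → a ∼ b → L a ≡ L b

  class-saturated : ∀ x → Saturated (class x)
  class-saturated x a∼b = does-⇔ (mk⇔ (∼-trans (∼-sym a∼b)) (∼-trans a∼b)) (_ ≟ x) (_ ≟ x)

  saturated⇒class-size∣count : ∀ {d} → (∀ x → count (class x) ≡ d) →
                               ∀ L → Saturated L → d ∣ count L
  saturated⇒class-size∣count {d} class-size L = go (suc (count L)) L ≤-refl
    where
    go : ∀ fuel L → count L < fuel → Saturated L → d ∣ count L
    go (suc fuel) L count<fuel L-sat with any? (λ z → L z Bool.≟ true)
    ... | no ∄x = subst (d ∣_) (sym (trans (count-cong L≗false) (count-false {n}))) (d ∣0)
      where
      L≗false : L ≗ λ _ → false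
      L≗false z = ¬-not (λ Lz → ∄x (z , Lz))
    ... | yes (x , Lx) = subst (d ∣_) (sym count≡d+count-rest) (∣m∣n⇒∣m+n ∣-refl rest-divisible)
      where
      rest : Fin n → Bool
      rest z = L z ∧ not (class x z)
      L∧class≗class : (λ z → L z ∧ class x z) ≗ class x
      L∧class≗class z with z ≟ x
      ... | yes z∼x rewrite L-sat z∼x | Lx = refl
      ... | no  _   = ∧-zeroʳ (L z)
      count≡d+count-rest : count L ≡ d + count rest
      count≡d+count-rest = trans (count-∧-split L (class x))
                                 (cong (_+ count rest) (trans (count-cong L∧class≗class) (class-size x)))
      0<d : 0 < d
      0<d = subst (0 <_) (class-size x) (count-pos (class x) (dec-true (x ≟ x) ∼-refl))
      rest-divisible : d ∣ count rest
      rest-divisible = go fuel rest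
        (≤-trans (+-monoˡ-≤ (count rest) 0<d) (subst (_≤ fuel) count≡d+count-rest (s≤s⁻¹ count<fuel)))
        (λ a∼b → cong₂ (λ u v → u ∧ not v) (L-sat a∼b) (class-saturated x a∼b))

Interval : ℕ → ℕ → ℕ → Set
Interval a l x = a ≤ x × x < a + l

interval? : ∀ a l x → Dec (Interval a l x)
interval? a l x = a ≤? x ×-dec x <? a + l

count-interval : ∀ {n} a l → a + l ≤ n → count {n} (λ z → does (interval? a l (toℕ z))) ≡ l
count-interval {n}     zero    zero    _        = count-false {n}
count-interval {suc n} zero    (suc l) (s≤s le) = cong suc (count-interval zero l le)
count-interval {suc n} (suc a) l       (s≤s le) = trans (count-cong shift) (count-interval a l le)
  where
  shift : ∀ (z : Fin n) → does (suc a ≤? suc (toℕ z)) ∧ does (toℕ z <? a + l)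
                        ≡ does (a ≤? toℕ z) ∧ does (toℕ z <? a + l)
  shift z = cong (_∧ does (toℕ z <? a + l))
                 (does-⇔ (mk⇔ s≤s⁻¹ s≤s) (suc a ≤? suc (toℕ z)) (a ≤? toℕ z))

prefix-covering : ∀ {m} (l : Fin m → ℕ) {x} → x < sumF l → ∃ λ i → Interval (pre l i) (l i) x
prefix-covering {suc m} l {x} x<Σ with x <? l zero
... | yes x<l₀ = zero , z≤n , x<l₀
... | no  x≮l₀ with m≤n⇒∃[o]m+o≡n (≮⇒≥ x≮l₀)
...   | x′ , refl with prefix-covering (l ∘ suc) (+-cancelˡ-< (l zero) _ _ x<Σ)
...     | i , pre≤x′ , x′<pre+l =
  suc i , +-monoʳ-≤ (l zero) pre≤x′ ,
  subst (l zero + x′ <_) (sym (+-assoc (l zero) _ _)) (+-monoʳ-< (l zero) x′<pre+l)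

prefix-bounded : ∀ {m} (l : Fin m → ℕ) i → pre l i + l i ≤ sumF l
prefix-bounded l zero    = m≤m+n (l zero) _
prefix-bounded l (suc i) =
  subst (_≤ sumF l) (sym (+-assoc (l zero) _ _)) (+-monoʳ-≤ (l zero) (prefix-bounded (l ∘ suc) i))

slope-injective : ∀ {g} (N : NewtonPolygon g) → Injective _≡_ _≡_ (slope N)
slope-injective N {i} {j} sᵢ≡sⱼ with <-cmpᶠ i j
... | tri< i<j _ _ = ⊥-elim (ℚ.<-irrefl sᵢ≡sⱼ (increasing N i j i<j))
... | tri≈ _ i≡j _ = i≡j
... | tri> _ _ j<i = ⊥-elim (ℚ.<-irrefl (sym sᵢ≡sⱼ) (increasing N j i j<i))

module _ {g} (N : NewtonPolygon g) where

  Block : Fin (m N) → X g → Set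
  Block i z = Interval (pre (len N) i) (len N i) (toℕ z)

  block : Fin (m N) → X g → Bool
  block i z = does (interval? (pre (len N) i) (len N i) (toℕ z))

  count-block : ∀ i → count (block i) ≡ len N i
  count-block i = count-interval (pre (len N) i) (len N i)
    (subst (pre (len N) i + len N i ≤_) (total N) (prefix-bounded (len N) i))

  module _ {w : X g → ℚ} (w-assoc : IsAssociatedWeight N w) where

    Block-of-weight : ∀ i z → w z ≡ slope N i → Block i z
    Block-of-weight i z wz≡sᵢ with prefix-covering (len N) (subst (toℕ z <_) (sym (total N)) (toℕ<n z))
    ... | j , (p , q) =
      subst (λ k → Block k z) (slope-injective N (trans (sym (w-assoc z j p q)) wz≡sᵢ)) (p , q)

    block-respects-weight : ∀ i {a b} → w a ≡ w b → block i a ≡ block i b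
    block-respects-weight i {a} {b} wa≡wb =
      does-⇔ (mk⇔ a→b b→a) (interval? _ _ (toℕ a)) (interval? _ _ (toℕ b))
      where
      a→b : Block i a → Block i b
      a→b (p , q) = Block-of-weight i b (trans (sym wa≡wb) (w-assoc a i p q))
      b→a : Block i b → Block i a
      b→a (p , q) = Block-of-weight i a (trans wa≡wb (w-assoc b i p q))

gcdF-greatest : ∀ {m} (l : Fin m → ℕ) {d} → (∀ i → d ∣ l i) → d ∣ gcdF l
gcdF-greatest {zero}  l d∣l = _ ∣0
gcdF-greatest {suc m} l d∣l = gcd-greatest (d∣l zero) (gcdF-greatest (l ∘ suc) (d∣l ∘ suc))

¬¬-Π-Fin : ∀ {n p} {P : Fin n → Set p} → (∀ i → ¬ ¬ P i) → ¬ ¬ (∀ i → P i)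
¬¬-Π-Fin {zero}  _   k = k (λ ())
¬¬-Π-Fin {suc n} ¬¬P k = ¬¬P zero (λ P₀ → ¬¬-Π-Fin (¬¬P ∘ suc) (λ P₊ → k (∀-cons P₀ P₊)))

module Indistinguishability {g} (G : Perm g → Set) (G-subgroup : IsSubgroupOfW g G) (w : X g → ℚ) where
  open IsSubgroupOfW G-subgroup using (id∈; ·∈; inv∈)

  infix 4 _∼_
  _∼_ : Rel (X g) 0ℓ
  a ∼ b = ∀ k → G k → w (app k a) ≡ w (app k b)

  ∼-isEquivalence : IsEquivalence _∼_
  ∼-isEquivalence = record
    { refl  = λ _ _ → refl
    ; sym   = λ a∼b k Gk → sym (a∼b k Gk)
    ; trans = λ a∼b b∼c k Gk → trans (a∼b k Gk) (b∼c k Gk)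
    }

  ∼-translate : ∀ {h a b} → G h → a ∼ b → app h a ∼ app h b
  ∼-translate {h} Gh a∼b k Gk = a∼b (k · h) (·∈ k h Gk Gh)

  ∼⇒weight≡ : ∀ {a b} → a ∼ b → w a ≡ w b
  ∼⇒weight≡ a∼b = a∼b (perm id) id∈

  ¬¬-∼-decidable : ¬ ¬ Decidable _∼_
  ¬¬-∼-decidable = ¬¬-Π-Fin (λ a → ¬¬-Π-Fin (λ b → ¬¬-excluded-middle))

  module _ (G-transitive : Transitive G) (_∼?_ : Decidable _∼_) where

    ∼-isDecEquivalence : IsDecEquivalence _∼_
    ∼-isDecEquivalence = record { isEquivalence = ∼-isEquivalence ; _≟_ = _∼?_ }

    [_] : X g → X g → Bool
    [_] = class ∼-isDecEquivalence

    class-size-constant : ∀ x y → count [ x ] ≡ count [ y ]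
    class-size-constant x y with G-transitive x y
    ... | h , Gh , hx≡y = trans (count-permute [ x ] (flip (π h))) (sym (count-cong class-translate))
      where
      class-translate : [ y ] ≗ [ x ] ∘ appInv h
      class-translate z = does-⇔ (mk⇔ to from) (z ∼? y) (appInv h z ∼? x)
        where
        to : z ∼ y → appInv h z ∼ x
        to z∼y = subst (appInv h z ∼_) (trans (cong (appInv h) (sym hx≡y)) (inverseˡ (π h)))
                       (∼-translate (inv∈ h Gh) z∼y)
        from : appInv h z ∼ x → z ∼ y
        from h⁻¹z∼x = subst₂ _∼_ (inverseʳ (π h)) hx≡y (∼-translate Gh h⁻¹z∼x)

    ∼⇒≡-decidable : (N : NewtonPolygon g) → IsAssociatedWeight N w → gcdF (len N) ≡ 1 →
                    ∀ {a b} → a ∼ b → a ≡ b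
    ∼⇒≡-decidable N w-assoc gcd≡1 {a} {b} a∼b with a Fin.≟ b
    ... | yes a≡b = a≡b
    ... | no  a≢b = ⊥-elim (1+n≰n (subst (1 <_) class-size≡1 1<class-size))
      where
      class-size∣len : ∀ i → count [ b ] ∣ len N i
      class-size∣len i = subst (count [ b ] ∣_) (count-block N i)
        (saturated⇒class-size∣count ∼-isDecEquivalence (λ x → class-size-constant x b) (block N i)
          (block-respects-weight N w-assoc i ∘ ∼⇒weight≡))
      class-size≡1 : count [ b ] ≡ 1
      class-size≡1 = ∣1⇒≡1 (subst (count [ b ] ∣_) gcd≡1 (gcdF-greatest (len N) class-size∣len))
      1<class-size : 1 < count [ b ]
      1<class-size =
        distinct⇒1<count [ b ] a≢b (dec-true (a ∼? b) a∼b) (dec-true (b ∼? b) (λ _ _ → refl))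

  ∼⇒≡ : Transitive G → (N : NewtonPolygon g) → IsAssociatedWeight N w → gcdF (len N) ≡ 1 →
        ∀ {a b} → a ∼ b → a ≡ b
  ∼⇒≡ G-transitive N w-assoc gcd≡1 {a} {b} a∼b = decidable-stable (a Fin.≟ b) λ a≢b →
    ¬¬-∼-decidable (λ ∼? → a≢b (∼⇒≡-decidable G-transitive ∼? N w-assoc gcd≡1 a∼b))

lemma6p7 : (g : ℕ) → .{{_ : NonZero g}} →
    (G : Perm g → Set) → IsSubgroupOfW g G → Transitive G → Containsι G →
    (N : NewtonPolygon g) → (w : X g → ℚ) → IsAssociatedWeight N w →
    gcdF (len N) ≡ 1 →
    GeometricallySimple g w G
lemma6p7 g G G-subgroup G-transitive _ N w w-assoc gcd≡1 τ _ = stabilises⇒fixes , fixes⇒stabilises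
  where
  open Indistinguishability G G-subgroup w
  open IsSubgroupOfW G-subgroup using (inv∈)

  stabilises⇒fixes : actQG τ (Φ w (one g)) ≈[ G ] Φ w (one g) → app τ (one g) ≡ one g
  -- At σ = k⁻¹ the coefficients of τ·Φ(1) and Φ(1) are w(k(τ 1)) and w(k 1).
  stabilises⇒fixes τΦ≈Φ = ∼⇒≡ G-transitive N w-assoc gcd≡1 (λ k Gk → τΦ≈Φ (inv k) (inv∈ k Gk))

  fixes⇒stabilises : app τ (one g) ≡ one g → actQG τ (Φ w (one g)) ≈[ G ] Φ w (one g)
  fixes⇒stabilises τ1≡1 σ _ = cong (w ∘ appInv σ) τ1≡1
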